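{- Let $K=\mathbb{Q}(\sqrt{ -d})$ with $d>0$ squarefree and $-d\equiv 1\pmod 4$, and let $S$ be a finite set of rational primes with $2\notin S$, and let $p\in S$ with $p\mid d$. Let $\xi=(x+yw)/z\in K$ with $x,y,z\in\mathbb{Z}$, $z\neq0$ not divisible by any prime of $S$, and $\alpha=(a+bw)/c$ with $a,b\in\mathbb{Z}$, $c\in T$. If $c\equiv 0\pmod p$, $b\not\equiv 0\pmod p$ and $2a+b\equiv 0\pmod p$, then $$N_S(\xi-\alpha)\le \frac{c^2}{p}N(\xi-\alpha).$$ Consequently, $K$ is $S$-norm-Euclidean provided that for every $\xi\in K\cap\mathcal{F}$ there exists $\alpha\in\mathcal{O}_S$ such that either $|\xi-\alpha|<1/\mathrm{denom}_S(\alpha)$, or $\alpha=(a+bw)/c$ with $a,b\in\mathbb{Z}$, $c\in T$ satisfying $c\equiv 0\pmod p$, $b\not\equiv 0\pmod p$, $2a+b\equiv 0\pmod p$ and $|\xi-\alpha|<\sqrt{p}/c$.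
   Context: Here $w=(1+\sqrt{ -d})/2$; $K\subseteq\mathbb{C}$ and $|\cdot|$ is the complex modulus. The norm is $N(x+y\sqrt{ -d})=x^2+dy^2$. $T$ is the set of positive integers all of whose prime factors lie in $S$ (so $1\in T$), and $\mathcal{O}_S=\{(a+bw)/c: a,b\in\mathbb{Z}, c\in T\}$. For $\alpha\in\mathcal{O}_S$, $\mathrm{denom}_S(\alpha)$ is the minimal $c$ over all representations $\alpha=(a+bw)/c$ with $a,b\in\mathbb{Z}$, $c\in T$. $\mathcal{F}=\{x+yw: x,y\in\mathbb{R},\ 0\le x,y\le 1\}$. For nonzero $\xi\in K$, $N_S(\xi)$ is the positive rational obtained from $N(\xi)$ by deleting all primes of $S$ from the prime factorizations of its numerator and denominator; $N_S(0)=0$. $K$ is $S$-norm-Euclidean if for every $\xi\in K$ there exists $\gamma\in\mathcal{O}_S$ with $N_S(\xi-\gamma)<1$. -}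

module Defs where

open import Data.Nat as ℕ using (ℕ; zero; suc; _≤_)
open import Data.Nat.Divisibility using (_∣_; _∣?_)
open import Data.Nat.DivMod using (_/_)
open import Data.Nat.Primality using (Prime)
open import Data.Integer as ℤ using (ℤ; +_; -[1+_]; +[1+_]; ∣_∣)
open import Data.Rational as ℚ using (ℚ; 0ℚ; 1ℚ)
open import Data.List using (List; foldr)
open import Data.List.Membership.Propositional using (_∈_)
open import Data.Product using (Σ; ∃; _×_; _,_)
open import Data.Sum using (_⊎_)
open import Relation.Nullary using (¬_; yes; no)
open import Relation.Binary.PropositionalEquality using (_≡_; _≢_)

-- a / b as a rational, for natural a, b (b ≠ 0 in all uses; 0 if b = 0)
ratio : ℕ → ℕ → ℚ
ratio a zero    = 0ℚ
ratio a (suc b) = (+ a) ℚ./ suc b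

-- x / z as a rational, for integers x, z (z ≠ 0 in all uses; 0 if z = 0)
zdiv : ℤ → ℤ → ℚ
zdiv x (+ zero)     = 0ℚ
zdiv x +[1+ n ]     = x ℚ./ suc n
zdiv x -[1+ n ]     = (ℤ.- x) ℚ./ suc n

Squarefree : ℕ → Set
Squarefree d = ∀ n → n ℕ.* n ∣ d → n ≡ 1

InT : List ℕ → ℕ → Set
InT S c = (c ≢ 0) × (∀ q → Prime q → q ∣ c → q ∈ S)

stripFuel : ℕ → ℕ → ℕ → ℕ
stripFuel (suc (suc q)) (suc k) n with suc (suc q) ∣? n
... | yes _ = stripFuel (suc (suc q)) k (n / suc (suc q))
... | no  _ = n
stripFuel _ _ n = n

strip : ℕ → ℕ → ℕ
strip p n = stripFuel p n n

removeS : List ℕ → ℕ → ℕ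
removeS S n = foldr strip n S

-- N_S on a (nonnegative) rational: delete the primes of S from numerator
-- and denominator.  (Gives 0 on 0.)
NSℚ : List ℕ → ℚ → ℚ
NSℚ S q = ratio (removeS S ∣ ℚ.numerator q ∣) (removeS S (ℚ.denominatorℕ q))

-- The field K = ℚ(√-d): an element  u + v w  with  w = (1 + √-d)/2

record K : Set where
  constructor _+_w
  field
    re : ℚ
    im : ℚ
open K public

_-K_ : K → K → K
(u + v w) -K (u' + v' w) = (u ℚ.- u') + (v ℚ.- v') w

-- u + v w = (u + v/2) + (v/2) √-d, so N = (u + v/2)^2 + d (v/2)^2
Norm : ℕ → K → ℚ
Norm d (u + v w) =
  (u ℚ.+ ratio 1 2 ℚ.* v) ℚ.* (u ℚ.+ ratio 1 2 ℚ.* v)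
  ℚ.+ ratio d 1 ℚ.* ((ratio 1 2 ℚ.* v) ℚ.* (ratio 1 2 ℚ.* v))

NormS : ℕ → List ℕ → K → ℚ
NormS d S ξ = NSℚ S (Norm d ξ)

repr : ℤ → ℤ → ℕ → K
repr a b c = zdiv a (+ c) + zdiv b (+ c) w

RepS : List ℕ → K → ℤ → ℤ → ℕ → Set
RepS S α a b c = InT S c × (α ≡ repr a b c)

InOS : List ℕ → K → Set
InOS S α = Σ ℤ λ a → Σ ℤ λ b → Σ ℕ λ c → RepS S α a b c

IsDenomS : List ℕ → K → ℕ → Set
IsDenomS S α c =
  (Σ ℤ λ a → Σ ℤ λ b → RepS S α a b c)
  × (∀ a' b' c' → RepS S α a' b' c' → c ≤ c')

InF : K → Set
InF (u + v w) = (0ℚ ℚ.≤ u) × (u ℚ.≤ 1ℚ) × (0ℚ ℚ.≤ v) × (v ℚ.≤ 1ℚ)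

SNormEuclidean : ℕ → List ℕ → Set
SNormEuclidean d S =
  ∀ (ξ : K) → Σ K λ γ → InOS S γ × (NormS d S (ξ -K γ) ℚ.< 1ℚ)

PCond : ℕ → ℤ → ℤ → ℕ → Set
PCond p a b c = (p ∣ c) × (¬ (p ∣ ∣ b ∣)) × (p ∣ ∣ (+ 2) ℤ.* a ℤ.+ b ∣)

-- Write ξ − α = (W + Y √-d) / (2zc).  Then N(ξ − α) = (W² + dY²) / (4z²c²), and under the
-- p-condition p divides c, 2a + b and d, hence p divides W² + dY².  Deleting the primes of S
-- from this fraction can enlarge it at most by the S-part of c² and must shrink it at least by
-- the factor p of the numerator, because 4z² contains no prime of S (z is S-free and 2 ∉ S).
--
-- For the Euclidean criterion, write the denominator of ξ as R·s with R S-free and s a product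
-- of primes of S.  Using eR + fs = 1, ξ differs by an element β of O_S from some (x + yw)/R
-- with 0 ≤ x, y < R, a point of F.  Approximating that point by α and applying the bound above
-- (with p, or with 1 in place of p) gives N_S(ξ − (α + β)) < 1.

{-# OPTIONS --safe #-}
module Submission where

open import Defs
open import Data.Nat as ℕ using (ℕ; zero; suc; _%_; _<_; _≤_; _^_; z≤n; s≤s; NonZero; 2+)
import Data.Nat.Properties as ℕP
open import Data.Nat.Divisibility
  using (_∣_; _∣?_; divides; divides-refl; 1∣_; ∣-trans; ∣⇒≤; ∣1⇒≡1; m∣m*n; n∣m*n; ∣m⇒∣m*n; ∣m∣n⇒∣m+n; *-pres-∣; *-monoʳ-∣; *-cancelˡ-∣)
open import Data.Nat.DivMod using (m*n/n≡m)
open import Data.Nat.Primality using (Prime; euclidsLemma; prime⇒nonZero; prime⇒irreducible; prime[2]; ¬prime[0]; ¬prime[1])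
open import Data.Nat.Coprimality using (Coprime; coprime-Bézout)
open import Data.Nat.GCD using (module Bézout)
import Data.Nat.Tactic.RingSolver as ℕ-Solver
open import Data.Integer as ℤ using (ℤ; +_; +[1+_]; -[1+_]; ∣_∣)
import Data.Integer.Properties as ℤP
import Data.Integer.DivMod as ℤ÷
import Data.Integer.Divisibility.Signed as ℤ∣
import Data.Integer.Tactic.RingSolver as ℤ-Solver
open import Data.Rational as ℚ using (ℚ; mkℚ; toℚᵘ; 0ℚ; 1ℚ; ↧ₙ_)
import Data.Rational.Properties as ℚP
open import Data.Rational.Solver using (module +-*-Solver)
open import Data.Rational.Unnormalised as ℚᵘ using (ℚᵘ; mkℚᵘ; *≡*; *≤*; *<*)
import Data.Rational.Unnormalised.Properties as ℚᵘP
open import Data.List using (List; []; _∷_)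
open import Data.List.Relation.Unary.All using (All; []; _∷_)
import Data.List.Relation.Unary.All as All
open import Data.List.Relation.Unary.Any using (here; there)
open import Data.List.Membership.Propositional using (_∈_; _∉_)
open import Data.Product using (Σ; _×_; _,_; proj₁; proj₂)
open import Data.Sum using (_⊎_; inj₁; inj₂; [_,_]′)
open import Data.Empty using (⊥-elim)
open import Relation.Nullary using (¬_; yes; no)
open import Relation.Binary.PropositionalEquality

-- S-free and S-smooth numbers

SFree : List ℕ → ℕ → Set
SFree S r = ∀ q → q ∈ S → ¬ (q ∣ r)

data Smooth (S : List ℕ) : ℕ → Set where
  one   : Smooth S 1
  times : ∀ {q s} → q ∈ S → Smooth S s → Smooth S (q ℕ.* s)

InT-* : ∀ {S m n} → InT S m → InT S n → InT S (m ℕ.* n)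
InT-* {m = m} {n} (m≢0 , m-factors) (n≢0 , n-factors) =
  ℕ.≢-nonZero⁻¹ _ {{ℕP.m*n≢0 m n {{ℕ.≢-nonZero m≢0}} {{ℕ.≢-nonZero n≢0}}}} ,
  λ q pq q∣mn → [ m-factors q pq , n-factors q pq ]′ (euclidsLemma m n pq q∣mn)

module _ {S : List ℕ} where

  Smooth-∈ : ∀ {q} → q ∈ S → Smooth S q
  Smooth-∈ {q} q∈S = subst (Smooth S) (ℕP.*-identityʳ q) (times q∈S one)

  Smooth-* : ∀ {m n} → Smooth S m → Smooth S n → Smooth S (m ℕ.* n)
  Smooth-* {n = n} one sn = subst (Smooth S) (sym (ℕP.+-identityʳ n)) sn
  Smooth-* {n = n} (times {q} {s} q∈S ss) sn =
    subst (Smooth S) (sym (ℕP.*-assoc q s n)) (times q∈S (Smooth-* ss sn))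

  Smooth-^ : ∀ {q} → q ∈ S → ∀ j → Smooth S (q ^ j)
  Smooth-^ q∈S zero    = one
  Smooth-^ q∈S (suc j) = times q∈S (Smooth-^ q∈S j)

  Smooth-there : ∀ {p s} → Smooth S s → Smooth (p ∷ S) s
  Smooth-there one            = one
  Smooth-there (times q∈S ss) = times (there q∈S) (Smooth-there ss)

  SFree-∣ : ∀ {m n} → SFree S n → m ∣ n → SFree S m
  SFree-∣ free m∣n q q∈S q∣m = free q q∈S (∣-trans q∣m m∣n)

  module _ (primes : All Prime S) where

    SFree-* : ∀ {m n} → SFree S m → SFree S n → SFree S (m ℕ.* n)
    SFree-* {m} {n} free-m free-n q q∈S q∣mn with euclidsLemma m n (All.lookup primes q∈S) q∣mn
    ... | inj₁ q∣m = free-m q q∈S q∣m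
    ... | inj₂ q∣n = free-n q q∈S q∣n

    Smooth⇒InT : ∀ {s} → Smooth S s → InT S s
    Smooth⇒InT one = (λ ()) , λ q pq q∣1 → ⊥-elim (¬prime[1] (subst Prime (∣1⇒≡1 q∣1) pq))
    Smooth⇒InT (times {q₁} {s} q₁∈S ss) = q₁s≢0 , factors
      where
      pq₁ = All.lookup primes q₁∈S
      q₁s≢0 : q₁ ℕ.* s ≢ 0
      q₁s≢0 = ℕ.≢-nonZero⁻¹ _ {{ℕP.m*n≢0 q₁ s {{prime⇒nonZero pq₁}} {{ℕ.≢-nonZero (proj₁ (Smooth⇒InT ss))}}}}
      factors : ∀ q → Prime q → q ∣ q₁ ℕ.* s → q ∈ S
      factors q pq q∣q₁s with euclidsLemma q₁ s pq q∣q₁s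
      ... | inj₂ q∣s = proj₂ (Smooth⇒InT ss) q pq q∣s
      ... | inj₁ q∣q₁ with prime⇒irreducible pq₁ q∣q₁
      ...   | inj₁ refl = ⊥-elim (¬prime[1] pq)
      ...   | inj₂ refl = q₁∈S

    Smooth-∣-SFree-* : ∀ {s r n} → Smooth S s → SFree S r → s ∣ r ℕ.* n → s ∣ n
    Smooth-∣-SFree-* one free _ = 1∣ _
    Smooth-∣-SFree-* {r = r} {n} (times {q} {s} q∈S ss) free qs∣rn
      with euclidsLemma r n (All.lookup primes q∈S) (∣-trans (m∣m*n s) qs∣rn)
    ... | inj₁ q∣r = ⊥-elim (free q q∈S q∣r)
    ... | inj₂ (divides-refl k) = subst (q ℕ.* s ∣_) (ℕP.*-comm q k) (*-monoʳ-∣ q s∣k)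
      where
      instance _ = prime⇒nonZero (All.lookup primes q∈S)
      rearrange : ∀ r k q → r ℕ.* (k ℕ.* q) ≡ q ℕ.* (r ℕ.* k)
      rearrange = ℕ-Solver.solve-∀
      s∣k : s ∣ k
      s∣k = Smooth-∣-SFree-* ss free (*-cancelˡ-∣ q (subst (q ℕ.* s ∣_) (rearrange r k q) qs∣rn))

    SFree-Smooth-coprime : ∀ {r s} → SFree S r → Smooth S s → Coprime r s
    SFree-Smooth-coprime {s = s} free ss {i} (divides-refl t , divides u s≡ui) =
      ∣1⇒≡1 (*-cancelˡ-∣ u {{u≢0}} (subst₂ _∣_ s≡ui (sym (ℕP.*-identityʳ u)) s∣u))
      where
      rearrange : ∀ t i u → t ℕ.* i ℕ.* u ≡ t ℕ.* (u ℕ.* i)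
      rearrange = ℕ-Solver.solve-∀
      s∣u : s ∣ u
      s∣u = Smooth-∣-SFree-* ss free (subst (_∣ t ℕ.* i ℕ.* u) (sym s≡ui) (divides t (rearrange t i u)))
      u≢0 = ℕP.m*n≢0⇒m≢0 u {{subst NonZero s≡ui (ℕ.≢-nonZero (proj₁ (Smooth⇒InT ss)))}}

-- Deleting the primes of S

stripFuel-spec : ∀ q k n .{{_ : NonZero n}} → n ≤ k →
  ¬ (2+ q ∣ stripFuel (2+ q) k n) × Σ ℕ λ j → n ≡ stripFuel (2+ q) k n ℕ.* 2+ q ^ j
stripFuel-spec q zero (suc n) ()
stripFuel-spec q (suc k) n n≤1+k with 2+ q ∣? n
... | no  q∤n = q∤n , 0 , sym (ℕP.*-identityʳ n)
... | yes (divides-refl m) rewrite m*n/n≡m m (2+ q) {{_}} =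
  let q∤r , j , m≡rqʲ = stripFuel-spec q k m {{m≢0}} m≤k
      r = stripFuel (2+ q) k m
  in q∤r , suc j , (begin
    m ℕ.* 2+ q                ≡⟨ cong (ℕ._* 2+ q) m≡rqʲ ⟩
    r ℕ.* 2+ q ^ j ℕ.* 2+ q   ≡⟨ ℕP.*-assoc r _ _ ⟩
    r ℕ.* (2+ q ^ j ℕ.* 2+ q) ≡⟨ cong (r ℕ.*_) (ℕP.*-comm (2+ q ^ j) _) ⟩
    r ℕ.* 2+ q ^ suc j        ∎)
  where
  open ≡-Reasoning
  m≢0 = ℕP.m*n≢0⇒m≢0 m
  m≤k : m ≤ k
  m≤k = ℕP.≤-pred (ℕP.≤-trans (ℕP.m<m*n m (2+ q) {{m≢0}} (s≤s (s≤s z≤n))) n≤1+k)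

removeS-spec : ∀ {S} → All Prime S → ∀ n .{{_ : NonZero n}} →
  SFree S (removeS S n) × Σ ℕ λ s → Smooth S s × n ≡ removeS S n ℕ.* s
removeS-spec [] n = (λ _ ()) , 1 , one , sym (ℕP.*-identityʳ n)
removeS-spec {0 ∷ _} (p0 ∷ _) _ = ⊥-elim (¬prime[0] p0)
removeS-spec {1 ∷ _} (p1 ∷ _) _ = ⊥-elim (¬prime[1] p1)
removeS-spec {2+ q ∷ S} (_ ∷ primes) n with removeS S n | removeS-spec primes n
... | r | free , s , smooth , n≡rs =
  free′ , 2+ q ^ j ℕ.* s , Smooth-* (Smooth-^ (here refl) j) (Smooth-there smooth) , (begin
    n                       ≡⟨ n≡rs ⟩
    r ℕ.* s                 ≡⟨ cong (ℕ._* s) r≡r′qʲ ⟩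
    r′ ℕ.* 2+ q ^ j ℕ.* s   ≡⟨ ℕP.*-assoc r′ _ s ⟩
    r′ ℕ.* (2+ q ^ j ℕ.* s) ∎)
  where
  open ≡-Reasoning
  instance _ = ℕP.m*n≢0⇒m≢0 r {{subst NonZero n≡rs (ℕ.≢-nonZero (ℕ.≢-nonZero⁻¹ n))}}
  r′ = stripFuel (2+ q) r r
  stripped = stripFuel-spec q r r ℕP.≤-refl
  j = proj₁ (proj₂ stripped)
  r≡r′qʲ = proj₂ (proj₂ stripped)
  free′ : SFree (2+ q ∷ S) r′
  free′ _ (here refl) = proj₁ stripped
  free′ p (there p∈S) = SFree-∣ free (divides (2+ q ^ j) (trans r≡r′qʲ (ℕP.*-comm r′ _))) p p∈S

removeS-nonZero : ∀ {S} → All Prime S → ∀ n .{{_ : NonZero n}} → NonZero (removeS S n)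
removeS-nonZero {S} primes n with removeS-spec primes n
... | _ , _ , _ , n≡rs = ℕP.m*n≢0⇒m≢0 (removeS S n) {{subst NonZero n≡rs (ℕ.≢-nonZero (ℕ.≢-nonZero⁻¹ n))}}

removeS-0 : ∀ S → removeS S 0 ≡ 0
removeS-0 []      = refl
removeS-0 (p ∷ S) rewrite removeS-0 S = strip-0 p
  where
  strip-0 : ∀ p → strip p 0 ≡ 0
  strip-0 zero       = refl
  strip-0 (suc zero) = refl
  strip-0 (2+ _)     = refl

-- With n = rn·sn and d = rd·sd split by removeS-spec, P·sd divides M·d = (rn·E)(sn·F), and
-- rn·E is S-free, so P·sd ≤ sn·F.
removeS-cross-≤ : ∀ {S} → All Prime S → ∀ {E P M} → SFree S E → Smooth S P → P ∣ M →
  ∀ n d F .{{_ : NonZero d}} .{{_ : NonZero F}} → n ℕ.* (E ℕ.* F) ≡ M ℕ.* d →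
  removeS S n ℕ.* (P ℕ.* d) ≤ F ℕ.* n ℕ.* removeS S d
removeS-cross-≤ {S} _ _ _ _ zero d F _ rewrite removeS-0 S = z≤n
removeS-cross-≤ {S} primes {E} {P} {M} free-E smooth-P P∣M n@(suc _) d F eq
  with removeS S n | removeS-spec primes n | removeS S d | removeS-spec primes d
... | rn | free-n , sn , _ , n≡rs | rd | _ , sd , smooth-d , d≡rs = begin
  rn ℕ.* (P ℕ.* d)           ≡⟨ cong (λ t → rn ℕ.* (P ℕ.* t)) d≡rs ⟩
  rn ℕ.* (P ℕ.* (rd ℕ.* sd)) ≡⟨ shuffle₁ rn P rd sd ⟩
  rn ℕ.* rd ℕ.* (P ℕ.* sd)   ≤⟨ ℕP.*-monoʳ-≤ (rn ℕ.* rd) (∣⇒≤ {{snF≢0}} Psd∣snF) ⟩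
  rn ℕ.* rd ℕ.* (sn ℕ.* F)   ≡⟨ shuffle₂ rn rd sn F ⟩
  F ℕ.* (rn ℕ.* sn) ℕ.* rd   ≡⟨ cong (λ t → F ℕ.* t ℕ.* rd) n≡rs ⟨
  F ℕ.* n ℕ.* rd             ∎
  where
  open ℕP.≤-Reasoning
  shuffle₁ : ∀ a b c e → a ℕ.* (b ℕ.* (c ℕ.* e)) ≡ a ℕ.* c ℕ.* (b ℕ.* e)
  shuffle₁ = ℕ-Solver.solve-∀
  shuffle₂ : ∀ a c e f → a ℕ.* c ℕ.* (e ℕ.* f) ≡ f ℕ.* (a ℕ.* e) ℕ.* c
  shuffle₂ = ℕ-Solver.solve-∀
  shuffle₃ : ∀ a e b f → a ℕ.* e ℕ.* (b ℕ.* f) ≡ a ℕ.* b ℕ.* (e ℕ.* f)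
  shuffle₃ = ℕ-Solver.solve-∀
  snF≢0 : NonZero (sn ℕ.* F)
  snF≢0 = ℕP.m*n≢0 sn F {{ℕP.m*n≢0⇒n≢0 rn {{subst NonZero n≡rs _}}}}
  Psd∣snF : P ℕ.* sd ∣ sn ℕ.* F
  Psd∣snF = Smooth-∣-SFree-* primes (Smooth-* smooth-P smooth-d) (SFree-* primes free-n free-E)
    (subst (P ℕ.* sd ∣_) (begin-equality
      M ℕ.* d                 ≡⟨ eq ⟨
      n ℕ.* (E ℕ.* F)         ≡⟨ cong (ℕ._* (E ℕ.* F)) n≡rs ⟩
      rn ℕ.* sn ℕ.* (E ℕ.* F) ≡⟨ shuffle₃ rn sn E F ⟩
      rn ℕ.* E ℕ.* (sn ℕ.* F) ∎)
    (*-pres-∣ P∣M (subst (sd ∣_) (sym d≡rs) (n∣m*n rd))))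

toℚᵘ-ratio : ∀ a b → toℚᵘ (ratio a (suc b)) ℚᵘ.≃ mkℚᵘ (+ a) b
toℚᵘ-ratio a b = ℚP.toℚᵘ-fromℚᵘ (mkℚᵘ (+ a) b)

ratio-* : ∀ a b c e .{{_ : NonZero b}} .{{_ : NonZero e}} →
  ratio a b ℚ.* ratio c e ≡ ratio (a ℕ.* c) (b ℕ.* e)
ratio-* a b@(suc b-1) c e@(suc e-1) = ℚP.toℚᵘ-injective (begin
  toℚᵘ (ratio a b ℚ.* ratio c e)          ≈⟨ ℚP.toℚᵘ-homo-* (ratio a b) _ ⟩
  toℚᵘ (ratio a b) ℚᵘ.* toℚᵘ (ratio c e)  ≈⟨ ℚᵘP.*-cong (toℚᵘ-ratio a b-1) (toℚᵘ-ratio c e-1) ⟩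
  mkℚᵘ (+ a) b-1 ℚᵘ.* mkℚᵘ (+ c) e-1      ≈⟨ ℚᵘP.≃-reflexive (cong (λ t → mkℚᵘ t _) (sym (ℤP.pos-* a c))) ⟩
  mkℚᵘ (+ (a ℕ.* c)) (ℕ.pred (b ℕ.* e))   ≈⟨ toℚᵘ-ratio (a ℕ.* c) _ ⟨
  toℚᵘ (ratio (a ℕ.* c) (b ℕ.* e))        ∎)
  where open ℚᵘP.≃-Reasoning

ratio-self : ∀ n .{{_ : NonZero n}} → ratio n n ≡ 1ℚ
ratio-self n@(suc n-1) = ℚP.toℚᵘ-injective (ℚᵘP.≃-trans (toℚᵘ-ratio n n-1) (*≡* (ℤP.*-comm (+ n) (+ 1))))

ratio-≤ : ∀ a b c e .{{_ : NonZero b}} .{{_ : NonZero e}} → a ℕ.* e ≤ c ℕ.* b → ratio a b ℚ.≤ ratio c e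
ratio-≤ a b@(suc b-1) c e@(suc e-1) ae≤cb = ℚP.toℚᵘ-cancel-≤
  (ℚᵘP.≤-respˡ-≃ (ℚᵘP.≃-sym (toℚᵘ-ratio a b-1)) (ℚᵘP.≤-respʳ-≃ (ℚᵘP.≃-sym (toℚᵘ-ratio c e-1))
    (*≤* (subst₂ ℤ._≤_ (ℤP.pos-* a e) (ℤP.pos-* c b) (ℤ.+≤+ ae≤cb)))))

ratio-< : ∀ a b c e .{{_ : NonZero b}} .{{_ : NonZero e}} → a ℕ.* e < c ℕ.* b → ratio a b ℚ.< ratio c e
ratio-< a b@(suc b-1) c e@(suc e-1) ae<cb = ℚP.toℚᵘ-cancel-<
  (ℚᵘP.<-respˡ-≃ (ℚᵘP.≃-sym (toℚᵘ-ratio a b-1)) (ℚᵘP.<-respʳ-≃ (ℚᵘP.≃-sym (toℚᵘ-ratio c e-1))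
    (*<* (subst₂ ℤ._<_ (ℤP.pos-* a e) (ℤP.pos-* c b) (ℤ.+<+ ae<cb)))))

<ratio⇒ratio-*<1 : ∀ A B .{{_ : NonZero A}} .{{_ : NonZero B}} {N} → N ℚ.< ratio B A → ratio A B ℚ.* N ℚ.< 1ℚ
<ratio⇒ratio-*<1 A@(suc _) B@(suc _) {N} N<B/A = begin-strict
  ratio A B ℚ.* N            <⟨ ℚP.*-monoʳ-<-pos (ratio A B) {{ℚ.positive (ratio-< 0 1 A B (s≤s z≤n))}} N<B/A ⟩
  ratio A B ℚ.* ratio B A    ≡⟨ ratio-* A B B A ⟩
  ratio (A ℕ.* B) (B ℕ.* A)  ≡⟨ cong (ratio (A ℕ.* B)) (ℕP.*-comm B A) ⟩
  ratio (A ℕ.* B) (A ℕ.* B)  ≡⟨ ratio-self (A ℕ.* B) ⟩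
  1ℚ                         ∎
  where open ℚP.≤-Reasoning

NSℚ-ratio-≤ : ∀ {S} → All Prime S → ∀ {E P M} → SFree S E → Smooth S P → P ∣ M →
  ∀ F {D} → E ℕ.* F ≡ suc D → NSℚ S (ratio M (suc D)) ℚ.≤ ratio F P ℚ.* ratio M (suc D)
NSℚ-ratio-≤ {S} primes {E} {P} {M} free-E smooth-P P∣M F {D} EF≡
  with (+ M) ℚ./ suc D | toℚᵘ-ratio M D
... | mkℚ -[1+ _ ] _ _ | *≡* e with () ← trans e (sym (ℤP.pos-* M _))
... | q@(mkℚ (+ n) den _) | *≡* e = begin
  ratio (removeS S n) (removeS S (suc den)) ≤⟨ ratio-≤ (removeS S n) _ (F ℕ.* n) (P ℕ.* suc den) cross ⟩
  ratio (F ℕ.* n) (P ℕ.* suc den)           ≡⟨ ratio-* F P n (suc den) ⟨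
  ratio F P ℚ.* ratio n (suc den)           ≡⟨ cong (ratio F P ℚ.*_) (ℚP.↥p/↧p≡p q) ⟩
  ratio F P ℚ.* q                           ∎
  where
  open ℚP.≤-Reasoning
  instance
    _ = removeS-nonZero primes (suc den)
    P≢0 = ℕ.≢-nonZero (proj₁ (Smooth⇒InT primes smooth-P))
    _ = ℕP.m*n≢0 P (suc den) {{P≢0}}
    _ = ℕP.m*n≢0⇒n≢0 E {F} {{subst NonZero (sym EF≡) _}}
  n·EF≡M·den : n ℕ.* (E ℕ.* F) ≡ M ℕ.* suc den
  n·EF≡M·den = ℤP.+-injective (trans (cong (λ t → + (n ℕ.* t)) EF≡)
    (trans (ℤP.pos-* n (suc D)) (trans e (sym (ℤP.pos-* M (suc den))))))
  cross : removeS S n ℕ.* (P ℕ.* suc den) ≤ F ℕ.* n ℕ.* removeS S (suc den)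
  cross = removeS-cross-≤ primes free-E smooth-P P∣M n (suc den) F n·EF≡M·den

-- The norm of a difference

Normᵘ : ℚᵘ → ℚᵘ → ℚᵘ → ℚᵘ
Normᵘ δ u v = (u ℚᵘ.+ ½v) ℚᵘ.* (u ℚᵘ.+ ½v) ℚᵘ.+ δ ℚᵘ.* (½v ℚᵘ.* ½v)
  where ½v = mkℚᵘ (+ 1) 1 ℚᵘ.* v

Normᵘ-cong : ∀ {δ δ′ u u′ v v′} → δ ℚᵘ.≃ δ′ → u ℚᵘ.≃ u′ → v ℚᵘ.≃ v′ → Normᵘ δ u v ℚᵘ.≃ Normᵘ δ′ u′ v′
Normᵘ-cong δ≃ u≃ v≃ = ℚᵘP.+-cong (ℚᵘP.*-cong sum≃ sum≃) (ℚᵘP.*-cong δ≃ (ℚᵘP.*-cong ½v≃ ½v≃))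
  where
  ½v≃ = ℚᵘP.*-congˡ {mkℚᵘ (+ 1) 1} v≃
  sum≃ = ℚᵘP.+-cong u≃ ½v≃

toℚᵘ-Norm : ∀ d u v → toℚᵘ (Norm d (u + v w)) ℚᵘ.≃ Normᵘ (toℚᵘ (ratio d 1)) (toℚᵘ u) (toℚᵘ v)
toℚᵘ-Norm d u v = ℚᵘP.≃-trans (+ᵘ (s ℚ.* s) _)
  (ℚᵘP.+-cong (ℚᵘP.≃-trans (*ᵘ s s) (ℚᵘP.*-cong s≃ s≃))
              (ℚᵘP.≃-trans (*ᵘ (ratio d 1) _)
                           (ℚᵘP.*-congˡ {toℚᵘ (ratio d 1)} (ℚᵘP.≃-trans (*ᵘ ½v ½v) (ℚᵘP.*-cong ½v≃ ½v≃)))))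
  where
  +ᵘ = ℚP.toℚᵘ-homo-+
  *ᵘ = ℚP.toℚᵘ-homo-*
  ½v = ratio 1 2 ℚ.* v
  s = u ℚ.+ ½v
  ½v≃ = *ᵘ (ratio 1 2) v
  s≃ = ℚᵘP.≃-trans (+ᵘ u ½v) (ℚᵘP.+-congʳ (toℚᵘ u) ½v≃)

Normᵘ-fraction : ∀ d U V D → Normᵘ (mkℚᵘ (+ d) 0) (mkℚᵘ U D) (mkℚᵘ V D) ℚᵘ.≃
  mkℚᵘ ((+ 2 ℤ.* U ℤ.+ V) ℤ.* (+ 2 ℤ.* U ℤ.+ V) ℤ.+ + d ℤ.* (V ℤ.* V)) (ℕ.pred (4 ℕ.* (suc D ℕ.* suc D)))
Normᵘ-fraction d U V D = *≡* (identity U V (+ suc D) (+ d))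
  where
  -- The numerator and denominator of the left-hand side, as the ℚᵘ operations compute them.
  identity : ∀ U V D δ →
    let T  = + 2 ℤ.* D
        A  = U ℤ.* T ℤ.+ (+ 1 ℤ.* V) ℤ.* D
        B  = D ℤ.* T
        V² = (+ 1 ℤ.* V) ℤ.* (+ 1 ℤ.* V)
    in (A ℤ.* A ℤ.* (+ 1 ℤ.* (T ℤ.* T)) ℤ.+ δ ℤ.* V² ℤ.* (B ℤ.* B)) ℤ.* (+ 4 ℤ.* (D ℤ.* D))
       ≡ ((+ 2 ℤ.* U ℤ.+ V) ℤ.* (+ 2 ℤ.* U ℤ.+ V) ℤ.+ δ ℤ.* (V ℤ.* V)) ℤ.* (B ℤ.* B ℤ.* (+ 1 ℤ.* (T ℤ.* T)))
  identity = ℤ-Solver.solve-∀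

-- 2zc ((x + yw)/z − (a + bw)/c) = scaledRe + scaledIm √-d.
scaledRe : ℤ → ℤ → ℤ → ℤ → ℕ → ℕ → ℤ
scaledRe x y a b z c = + c ℤ.* (+ 2 ℤ.* x ℤ.+ y) ℤ.- + z ℤ.* (+ 2 ℤ.* a ℤ.+ b)

scaledIm : ℤ → ℤ → ℕ → ℕ → ℤ
scaledIm y b z c = + c ℤ.* y ℤ.- + z ℤ.* b

normNumerator : ℕ → ℤ → ℤ → ℤ → ℤ → ℕ → ℕ → ℕ
normNumerator d x y a b z c = ∣ W ∣ ℕ.* ∣ W ∣ ℕ.+ d ℕ.* (∣ Y ∣ ℕ.* ∣ Y ∣)
  where
  W = scaledRe x y a b z c
  Y = scaledIm y b z c

+∣i∣*∣i∣≡i*i : ∀ i → + (∣ i ∣ ℕ.* ∣ i ∣) ≡ i ℤ.* i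
+∣i∣*∣i∣≡i*i (+ n)    = ℤP.pos-* n n
+∣i∣*∣i∣≡i*i -[1+ n ] = refl

toℚᵘ-zdiv-zdiv : ∀ x a z c → toℚᵘ (zdiv x (+ suc z) ℚ.- zdiv a (+ suc c)) ℚᵘ.≃ mkℚᵘ x z ℚᵘ.- mkℚᵘ a c
toℚᵘ-zdiv-zdiv x a z c = ℚᵘP.≃-trans (ℚP.toℚᵘ-homo-+ (zdiv x (+ suc z)) _)
  (ℚᵘP.+-cong (ℚP.toℚᵘ-fromℚᵘ (mkℚᵘ x z))
    (ℚᵘP.≃-trans (ℚP.toℚᵘ-homo‿- (zdiv a (+ suc c))) (ℚᵘP.-‿cong (ℚP.toℚᵘ-fromℚᵘ (mkℚᵘ a c)))))

Norm-repr-repr : ∀ d x y a b z c .{{_ : NonZero z}} .{{_ : NonZero c}} →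
  Norm d (repr x y z -K repr a b c) ≡ ratio (normNumerator d x y a b z c) (4 ℕ.* (z ℕ.* z) ℕ.* (c ℕ.* c))
Norm-repr-repr d x y a b z@(suc z-1) c@(suc c-1) = ℚP.toℚᵘ-injective (begin
  toℚᵘ (Norm d (repr x y z -K repr a b c))
    ≈⟨ toℚᵘ-Norm d (zdiv x (+ z) ℚ.- zdiv a (+ c)) (zdiv y (+ z) ℚ.- zdiv b (+ c)) ⟩
  Normᵘ (toℚᵘ (ratio d 1)) (toℚᵘ (zdiv x (+ z) ℚ.- zdiv a (+ c))) (toℚᵘ (zdiv y (+ z) ℚ.- zdiv b (+ c)))
    ≈⟨ Normᵘ-cong (toℚᵘ-ratio d 0) (toℚᵘ-zdiv-zdiv x a z-1 c-1) (toℚᵘ-zdiv-zdiv y b z-1 c-1) ⟩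
  Normᵘ (mkℚᵘ (+ d) 0) (mkℚᵘ x z-1 ℚᵘ.- mkℚᵘ a c-1) (mkℚᵘ y z-1 ℚᵘ.- mkℚᵘ b c-1)
    ≈⟨ Normᵘ-fraction d U V (ℕ.pred (z ℕ.* c)) ⟩
  mkℚᵘ ((+ 2 ℤ.* U ℤ.+ V) ℤ.* (+ 2 ℤ.* U ℤ.+ V) ℤ.+ + d ℤ.* (V ℤ.* V)) (ℕ.pred (4 ℕ.* (z ℕ.* c ℕ.* (z ℕ.* c))))
    ≡⟨ cong₂ mkℚᵘ numerator≡ (cong ℕ.pred (shuffle z c)) ⟩
  mkℚᵘ (+ normNumerator d x y a b z c) (ℕ.pred (4 ℕ.* (z ℕ.* z) ℕ.* (c ℕ.* c)))
    ≈⟨ toℚᵘ-ratio (normNumerator d x y a b z c) _ ⟨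
  toℚᵘ (ratio (normNumerator d x y a b z c) (4 ℕ.* (z ℕ.* z) ℕ.* (c ℕ.* c))) ∎)
  where
  open ℚᵘP.≃-Reasoning
  U = x ℤ.* + c ℤ.+ ℤ.- a ℤ.* + z
  V = y ℤ.* + c ℤ.+ ℤ.- b ℤ.* + z
  W = scaledRe x y a b z c
  Y = scaledIm y b z c
  regroup : ∀ x y a b z c δ →
    let U = x ℤ.* c ℤ.+ ℤ.- a ℤ.* z
        V = y ℤ.* c ℤ.+ ℤ.- b ℤ.* z
        W = c ℤ.* (+ 2 ℤ.* x ℤ.+ y) ℤ.- z ℤ.* (+ 2 ℤ.* a ℤ.+ b)
        Y = c ℤ.* y ℤ.- z ℤ.* b
    in (+ 2 ℤ.* U ℤ.+ V) ℤ.* (+ 2 ℤ.* U ℤ.+ V) ℤ.+ δ ℤ.* (V ℤ.* V) ≡ W ℤ.* W ℤ.+ δ ℤ.* (Y ℤ.* Y)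
  regroup = ℤ-Solver.solve-∀
  numerator≡ : (+ 2 ℤ.* U ℤ.+ V) ℤ.* (+ 2 ℤ.* U ℤ.+ V) ℤ.+ + d ℤ.* (V ℤ.* V) ≡ + normNumerator d x y a b z c
  numerator≡ = ≡.begin
    (+ 2 ℤ.* U ℤ.+ V) ℤ.* (+ 2 ℤ.* U ℤ.+ V) ℤ.+ + d ℤ.* (V ℤ.* V)
      ≡.≡⟨ regroup x y a b (+ z) (+ c) (+ d) ⟩
    W ℤ.* W ℤ.+ + d ℤ.* (Y ℤ.* Y)
      ≡.≡⟨ cong₂ (λ s t → s ℤ.+ + d ℤ.* t) (+∣i∣*∣i∣≡i*i W) (+∣i∣*∣i∣≡i*i Y) ⟨
    + (∣ W ∣ ℕ.* ∣ W ∣) ℤ.+ + d ℤ.* + (∣ Y ∣ ℕ.* ∣ Y ∣)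
      ≡.≡⟨ cong (ℤ._+_ (+ (∣ W ∣ ℕ.* ∣ W ∣))) (ℤP.pos-* d _) ⟨
    + (∣ W ∣ ℕ.* ∣ W ∣) ℤ.+ + (d ℕ.* (∣ Y ∣ ℕ.* ∣ Y ∣))
      ≡.≡⟨ ℤP.pos-+ (∣ W ∣ ℕ.* ∣ W ∣) _ ⟨
    + normNumerator d x y a b z c ≡.∎
    where module ≡ = ≡-Reasoning
  shuffle : ∀ z c → 4 ℕ.* (z ℕ.* c ℕ.* (z ℕ.* c)) ≡ 4 ℕ.* (z ℕ.* z) ℕ.* (c ℕ.* c)
  shuffle = ℕ-Solver.solve-∀

p∣normNumerator : ∀ {p} d x y a b z c → p ∣ d → p ∣ c → p ∣ ∣ + 2 ℤ.* a ℤ.+ b ∣ →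
  p ∣ normNumerator d x y a b z c
p∣normNumerator {p} d x y a b z c p∣d p∣c p∣2a+b =
  ∣m∣n⇒∣m+n (∣m⇒∣m*n ∣ scaledRe x y a b z c ∣ p∣W) (∣m⇒∣m*n _ p∣d)
  where
  p∣W : p ∣ ∣ scaledRe x y a b z c ∣
  p∣W = ℤ∣.∣⇒∣ᵤ (ℤ∣.∣m∣n⇒∣m-n (ℤ∣.∣m⇒∣m*n (+ 2 ℤ.* x ℤ.+ y) (ℤ∣.∣ᵤ⇒∣ {+ p} {+ c} p∣c))
                             (ℤ∣.∣n⇒∣m*n (+ z) (ℤ∣.∣ᵤ⇒∣ {+ p} p∣2a+b)))

SFree-4*z*z : ∀ {S} → All Prime S → 2 ∉ S → ∀ {z} → SFree S z → SFree S (4 ℕ.* (z ℕ.* z))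
SFree-4*z*z primes 2∉S free-z = SFree-* primes (SFree-* primes 2-free 2-free) (SFree-* primes free-z free-z)
  where
  2-free : SFree _ 2
  2-free q q∈S q∣2 with prime⇒irreducible prime[2] q∣2
  ... | inj₁ refl = ¬prime[1] (All.lookup primes q∈S)
  ... | inj₂ refl = 2∉S q∈S

NormS-repr-≤ : ∀ {S} → All Prime S → 2 ∉ S → ∀ {P} d x y a b z c .{{_ : NonZero z}} .{{_ : NonZero c}} →
  SFree S z → Smooth S P → P ∣ normNumerator d x y a b z c →
  NormS d S (repr x y z -K repr a b c) ℚ.≤ ratio (c ℕ.* c) P ℚ.* Norm d (repr x y z -K repr a b c)
NormS-repr-≤ {S} primes 2∉S {P} d x y a b z@(suc _) c@(suc _) free-z smooth-P P∣M =
  subst (λ q → NSℚ S q ℚ.≤ ratio (c ℕ.* c) P ℚ.* q) (sym (Norm-repr-repr d x y a b z c))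
    (NSℚ-ratio-≤ primes (SFree-4*z*z primes 2∉S free-z) smooth-P P∣M (c ℕ.* c)
      {ℕ.pred (4 ℕ.* (z ℕ.* z) ℕ.* (c ℕ.* c))} refl)

NormS-repr-<-1 : ∀ {S} → All Prime S → 2 ∉ S → ∀ {P} d x y a b z c .{{_ : NonZero z}} .{{_ : NonZero c}} →
  SFree S z → Smooth S P → P ∣ normNumerator d x y a b z c →
  Norm d (repr x y z -K repr a b c) ℚ.< ratio P (c ℕ.* c) → NormS d S (repr x y z -K repr a b c) ℚ.< 1ℚ
NormS-repr-<-1 primes 2∉S d x y a b z c free-z smooth-P P∣M N<P/c² =
  ℚP.≤-<-trans (NormS-repr-≤ primes 2∉S d x y a b z c free-z smooth-P P∣M)
               (<ratio⇒ratio-*<1 (c ℕ.* c) _ {{ℕP.m*n≢0 c c}} {{P≢0}} N<P/c²)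
  where P≢0 = ℕ.≢-nonZero (proj₁ (Smooth⇒InT primes smooth-P))

PCond⇒NormS-≤ : ∀ {S} → All Prime S → 2 ∉ S → ∀ {p d} → p ∈ S → p ∣ d →
  (x y z : ℤ) → z ≢ + 0 → SFree S ∣ z ∣ → (a b : ℤ) (c : ℕ) → InT S c → PCond p a b c →
  NormS d S ((zdiv x z + zdiv y z w) -K repr a b c)
    ℚ.≤ ratio (c ℕ.* c) p ℚ.* Norm d ((zdiv x z + zdiv y z w) -K repr a b c)
PCond⇒NormS-≤ _ _ _ _ _ _ (+ zero) z≢0 _ _ _ _ _ _ = ⊥-elim (z≢0 refl)
PCond⇒NormS-≤ primes 2∉S {d = d} p∈S p∣d x y +[1+ n ] _ free-z a b c (c≢0 , _) (p∣c , _ , p∣2a+b) =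
  NormS-repr-≤ primes 2∉S d x y a b (suc n) c free-z (Smooth-∈ p∈S)
    (p∣normNumerator d x y a b (suc n) c p∣d p∣c p∣2a+b)
  where instance _ = ℕ.≢-nonZero c≢0
PCond⇒NormS-≤ primes 2∉S {d = d} p∈S p∣d x y -[1+ n ] _ free-z a b c (c≢0 , _) (p∣c , _ , p∣2a+b) =
  NormS-repr-≤ primes 2∉S d (ℤ.- x) (ℤ.- y) a b (suc n) c free-z (Smooth-∈ p∈S)
    (p∣normNumerator d (ℤ.- x) (ℤ.- y) a b (suc n) c p∣d p∣c p∣2a+b)
  where instance _ = ℕ.≢-nonZero c≢0

infixl 6 _+K_
_+K_ : K → K → K
(u + v w) +K (u′ + v′ w) = (u ℚ.+ u′) + (v ℚ.+ v′) w

-K-+K : ∀ ξ α β → ξ -K (α +K β) ≡ (ξ -K β) -K α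
-K-+K (u + v w) (a + b w) (a′ + b′ w) = cong₂ _+_w (shift u a a′) (shift v b b′)
  where
  open +-*-Solver
  shift : ∀ u a b → u ℚ.- (a ℚ.+ b) ≡ (u ℚ.- b) ℚ.- a
  shift = solve 3 (λ u a b → u :- (a :+ b) := (u :- b) :- a) refl

zdiv-+ : ∀ i j m n .{{_ : NonZero m}} .{{_ : NonZero n}} →
  zdiv i (+ m) ℚ.+ zdiv j (+ n) ≡ zdiv (i ℤ.* + n ℤ.+ j ℤ.* + m) (+ (m ℕ.* n))
zdiv-+ i j m@(suc m-1) n@(suc n-1) = ℚP.toℚᵘ-injective (ℚᵘP.≃-trans (ℚP.toℚᵘ-homo-+ (zdiv i (+ m)) _)
  (ℚᵘP.≃-trans (ℚᵘP.+-cong (ℚP.toℚᵘ-fromℚᵘ (mkℚᵘ i m-1)) (ℚP.toℚᵘ-fromℚᵘ (mkℚᵘ j n-1)))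
    (ℚᵘP.≃-sym (ℚP.toℚᵘ-fromℚᵘ (mkℚᵘ (i ℤ.* + n ℤ.+ j ℤ.* + m) _)))))

repr-+K : ∀ a b a′ b′ m n .{{_ : NonZero m}} .{{_ : NonZero n}} →
  repr a b m +K repr a′ b′ n ≡ repr (a ℤ.* + n ℤ.+ a′ ℤ.* + m) (b ℤ.* + n ℤ.+ b′ ℤ.* + m) (m ℕ.* n)
repr-+K a b a′ b′ m n = cong₂ _+_w (zdiv-+ a a′ m n) (zdiv-+ b b′ m n)

+K-InOS : ∀ {S α β} → InOS S α → InOS S β → InOS S (α +K β)
+K-InOS (a , b , m , (m∈T@(m≢0 , _) , refl)) (a′ , b′ , n , (n∈T@(n≢0 , _) , refl)) =
  _ , _ , m ℕ.* n , InT-* m∈T n∈T , repr-+K a b a′ b′ m n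
  where instance
    _ = ℕ.≢-nonZero m≢0
    _ = ℕ.≢-nonZero n≢0

InF-repr : ∀ {x y R} .{{_ : NonZero R}} → x < R → y < R → InF (repr (+ x) (+ y) R)
InF-repr {x} {y} {R@(suc _)} x<R y<R = 0≤ x , ≤1 x<R , 0≤ y , ≤1 y<R
  where
  0≤ : ∀ x → 0ℚ ℚ.≤ ratio x R
  0≤ x = ratio-≤ 0 1 x R z≤n
  ≤1 : ∀ {x} → x < R → ratio x R ℚ.≤ 1ℚ
  ≤1 {x} x<R = subst (ratio x R ℚ.≤_) (ratio-self R) (ratio-≤ x R R R (ℕP.*-monoˡ-≤ R (ℕP.<⇒≤ x<R)))

-- Moving ξ into F along O_S

↧∣⇒≡zdiv : ∀ (u : ℚ) n .{{_ : NonZero n}} → ↧ₙ u ∣ n → Σ ℤ λ N → u ≡ zdiv N (+ n)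
↧∣⇒≡zdiv (mkℚ i den _) n@(suc n-1) (divides k n≡k·den) = i ℤ.* + k , ℚP.toℚᵘ-injective (begin
  mkℚᵘ i den                    ≈⟨ *≡* cross ⟩
  mkℚᵘ (i ℤ.* + k) n-1          ≈⟨ ℚP.toℚᵘ-fromℚᵘ (mkℚᵘ (i ℤ.* + k) n-1) ⟨
  toℚᵘ (zdiv (i ℤ.* + k) (+ n)) ∎)
  where
  open ℚᵘP.≃-Reasoning
  cross : i ℤ.* + n ≡ i ℤ.* + k ℤ.* + suc den
  cross = trans (cong (λ t → i ℤ.* + t) n≡k·den)
                (trans (cong (i ℤ.*_) (ℤP.pos-* k (suc den))) (sym (ℤP.*-assoc i (+ k) _)))

coprime-Bézoutℤ : ∀ {m n} → Coprime m n → Σ ℤ λ e → Σ ℤ λ f → e ℤ.* + m ℤ.+ f ℤ.* + n ≡ + 1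
coprime-Bézoutℤ {m} {n} m⊥n with coprime-Bézout m⊥n
... | Bézout.+- x y 1+yn≡xm = + x , ℤ.- + y , (begin
  + x ℤ.* + m ℤ.+ ℤ.- + y ℤ.* + n         ≡⟨ cong (λ t → t ℤ.+ ℤ.- + y ℤ.* + n) (toℤ 1+yn≡xm) ⟨
  + 1 ℤ.+ + y ℤ.* + n ℤ.+ ℤ.- + y ℤ.* + n ≡⟨ cancel (+ y) (+ n) ⟩
  + 1                                     ∎)
  where
  open ≡-Reasoning
  toℤ : 1 ℕ.+ y ℕ.* n ≡ x ℕ.* m → + 1 ℤ.+ + y ℤ.* + n ≡ + x ℤ.* + m
  toℤ eq = trans (cong (ℤ._+_ (+ 1)) (sym (ℤP.pos-* y n))) (trans (cong +_ eq) (ℤP.pos-* x m))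
  cancel : ∀ a b → + 1 ℤ.+ a ℤ.* b ℤ.+ ℤ.- a ℤ.* b ≡ + 1
  cancel = ℤ-Solver.solve-∀
... | Bézout.-+ x y 1+xm≡yn = ℤ.- + x , + y , (begin
  ℤ.- + x ℤ.* + m ℤ.+ + y ℤ.* + n           ≡⟨ cong (ℤ._+_ (ℤ.- + x ℤ.* + m)) (toℤ 1+xm≡yn) ⟨
  ℤ.- + x ℤ.* + m ℤ.+ (+ 1 ℤ.+ + x ℤ.* + m) ≡⟨ cancel (+ x) (+ m) ⟩
  + 1                                       ∎)
  where
  open ≡-Reasoning
  toℤ : 1 ℕ.+ x ℕ.* m ≡ y ℕ.* n → + 1 ℤ.+ + x ℤ.* + m ≡ + y ℤ.* + n
  toℤ eq = trans (cong (ℤ._+_ (+ 1)) (sym (ℤP.pos-* x m))) (trans (cong +_ eq) (ℤP.pos-* y n))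
  cancel : ∀ a b → ℤ.- a ℤ.* b ℤ.+ (+ 1 ℤ.+ a ℤ.* b) ≡ + 1
  cancel = ℤ-Solver.solve-∀

-- With eR + fs = 1 and Nf = x + kR:  N/(Rs) = (Ne + ks)/s + x/R.
split-fraction : ∀ N R s .{{_ : NonZero R}} .{{_ : NonZero s}} → Coprime R s →
  Σ ℕ λ x → x < R × Σ ℤ λ t → zdiv N (+ (R ℕ.* s)) ℚ.- zdiv t (+ s) ≡ zdiv (+ x) (+ R)
split-fraction N R@(suc R-1) s@(suc s-1) R⊥s with coprime-Bézoutℤ R⊥s
... | e , f , eR+fs≡1 = x , ℤ÷.n%ℕd<d (N ℤ.* f) R , t , ℚP.toℚᵘ-injective (begin
  toℚᵘ (zdiv N (+ (R ℕ.* s)) ℚ.- zdiv t (+ s)) ≈⟨ toℚᵘ-zdiv-zdiv N t (ℕ.pred (R ℕ.* s)) s-1 ⟩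
  mkℚᵘ N (ℕ.pred (R ℕ.* s)) ℚᵘ.- mkℚᵘ t s-1    ≈⟨ *≡* cross ⟩
  mkℚᵘ (+ x) R-1                               ≈⟨ ℚP.toℚᵘ-fromℚᵘ (mkℚᵘ (+ x) R-1) ⟨
  toℚᵘ (zdiv (+ x) (+ R))                      ∎)
  where
  open ℚᵘP.≃-Reasoning
  x = (N ℤ.* f) ℤ÷.%ℕ R
  k = (N ℤ.* f) ℤ÷./ℕ R
  t = N ℤ.* e ℤ.+ k ℤ.* + s
  x≡Nf-kR : + x ≡ N ℤ.* f ℤ.- k ℤ.* + R
  x≡Nf-kR = trans (add-sub (+ x) (k ℤ.* + R))
    (cong (ℤ._- k ℤ.* + R) (sym (ℤ÷.a≡a%ℕn+[a/ℕn]*n (N ℤ.* f) R)))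
    where
    add-sub : ∀ a b → a ≡ a ℤ.+ b ℤ.- b
    add-sub = ℤ-Solver.solve-∀
  expand : ∀ N e f k R s →
    (N ℤ.* s ℤ.+ ℤ.- (N ℤ.* e ℤ.+ k ℤ.* s) ℤ.* (R ℤ.* s)) ℤ.* R
      ≡ (N ℤ.* f ℤ.- k ℤ.* R) ℤ.* (R ℤ.* s ℤ.* s) ℤ.+ N ℤ.* R ℤ.* s ℤ.* (+ 1 ℤ.- (e ℤ.* R ℤ.+ f ℤ.* s))
  expand = ℤ-Solver.solve-∀
  drop-0 : ∀ a b → a ℤ.+ b ℤ.* (+ 1 ℤ.- + 1) ≡ a
  drop-0 = ℤ-Solver.solve-∀
  Q = (N ℤ.* f ℤ.- k ℤ.* + R) ℤ.* (+ R ℤ.* + s ℤ.* + s)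
  cross : (N ℤ.* + s ℤ.+ ℤ.- t ℤ.* + (R ℕ.* s)) ℤ.* + R ≡ + x ℤ.* (+ (R ℕ.* s) ℤ.* + s)
  cross = ≡.begin
    (N ℤ.* + s ℤ.+ ℤ.- t ℤ.* + (R ℕ.* s)) ℤ.* + R
      ≡.≡⟨ cong (λ r → (N ℤ.* + s ℤ.+ ℤ.- t ℤ.* r) ℤ.* + R) (ℤP.pos-* R s) ⟩
    (N ℤ.* + s ℤ.+ ℤ.- t ℤ.* (+ R ℤ.* + s)) ℤ.* + R
      ≡.≡⟨ expand N e f k (+ R) (+ s) ⟩
    Q ℤ.+ N ℤ.* + R ℤ.* + s ℤ.* (+ 1 ℤ.- (e ℤ.* + R ℤ.+ f ℤ.* + s))
      ≡.≡⟨ cong (λ b → Q ℤ.+ N ℤ.* + R ℤ.* + s ℤ.* (+ 1 ℤ.- b)) eR+fs≡1 ⟩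
    Q ℤ.+ N ℤ.* + R ℤ.* + s ℤ.* (+ 1 ℤ.- + 1)
      ≡.≡⟨ drop-0 Q (N ℤ.* + R ℤ.* + s) ⟩
    Q
      ≡.≡⟨ cong₂ ℤ._*_ x≡Nf-kR (cong (ℤ._* + s) (ℤP.pos-* R s)) ⟨
    + x ℤ.* (+ (R ℕ.* s) ℤ.* + s) ≡.∎
    where module ≡ = ≡-Reasoning

record ReductionToF (S : List ℕ) (ξ : K) : Set where
  field
    R x y   : ℕ
    {{R≢0}} : NonZero R
    R-free  : SFree S R
    x<R     : x < R
    y<R     : y < R
    β       : K
    β∈OS    : InOS S β
    ξ-β≡    : ξ -K β ≡ repr (+ x) (+ y) R

reduce-to-F : ∀ {S} → All Prime S → ∀ ξ → ReductionToF S ξ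
reduce-to-F {S} primes (u + v w) = reduction (removeS-spec primes (↧ₙ u ℕ.* ↧ₙ v) {{D≢0}})
  where
  D≢0 = ℕP.m*n≢0 (↧ₙ u) (↧ₙ v)
  R = removeS S (↧ₙ u ℕ.* ↧ₙ v)
  reduction : SFree S R × (Σ ℕ λ s → Smooth S s × ↧ₙ u ℕ.* ↧ₙ v ≡ R ℕ.* s) → ReductionToF S (u + v w)
  reduction (free-R , s , smooth-s , D≡Rs) =
    let Nu , u≡ = ↧∣⇒≡zdiv u (R ℕ.* s) (subst (↧ₙ u ∣_) D≡Rs (m∣m*n (↧ₙ v)))
        Nv , v≡ = ↧∣⇒≡zdiv v (R ℕ.* s) (subst (↧ₙ v ∣_) D≡Rs (n∣m*n (↧ₙ u)))
        x , x<R , tu , u-tu≡ = split-fraction Nu R s R⊥s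
        y , y<R , tv , v-tv≡ = split-fraction Nv R s R⊥s
    in record
      { R = R ; x = x ; y = y ; R-free = free-R ; x<R = x<R ; y<R = y<R
      ; β = repr tu tv s
      ; β∈OS = tu , tv , s , Smooth⇒InT primes smooth-s , refl
      ; ξ-β≡ = cong₂ _+_w (trans (cong (ℚ._- zdiv tu (+ s)) u≡) u-tu≡)
                         (trans (cong (ℚ._- zdiv tv (+ s)) v≡) v-tv≡)
      }
    where
    instance
      Rs≢0 : NonZero (R ℕ.* s)
      Rs≢0 = subst NonZero D≡Rs D≢0
      R≢0 : NonZero R
      R≢0 = ℕP.m*n≢0⇒m≢0 R
      s≢0 : NonZero s
      s≢0 = ℕP.m*n≢0⇒n≢0 R
    R⊥s = SFree-Smooth-coprime primes free-R smooth-s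

Approximation : ℕ → List ℕ → ℕ → K → K → Set
Approximation d S p ξ α =
  (Σ ℕ λ c → IsDenomS S α c × (Norm d (ξ -K α) ℚ.< ratio 1 (c ℕ.* c)))
  ⊎ (Σ ℤ λ a → Σ ℤ λ b → Σ ℕ λ c →
       RepS S α a b c × PCond p a b c × (Norm d (ξ -K α) ℚ.< ratio p (c ℕ.* c)))

-- In the first case only a representation with denominator c is used, not its minimality.
Approximation⇒NormS-<-1 : ∀ {d S p} → All Prime S → 2 ∉ S → p ∈ S → p ∣ d →
  ∀ x y R .{{_ : NonZero R}} → SFree S R → ∀ {α} → Approximation d S p (repr x y R) α →
  NormS d S (repr x y R -K α) ℚ.< 1ℚ
Approximation⇒NormS-<-1 {d} primes 2∉S p∈S p∣d x y R free-R
  (inj₁ (c , ((a , b , (c≢0 , _) , refl) , _) , N<1/c²)) =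
  NormS-repr-<-1 primes 2∉S d x y a b R c free-R one (1∣ _) N<1/c²
  where instance _ = ℕ.≢-nonZero c≢0
Approximation⇒NormS-<-1 {d} primes 2∉S p∈S p∣d x y R free-R
  (inj₂ (a , b , c , ((c≢0 , _) , refl) , (p∣c , _ , p∣2a+b) , N<p/c²)) =
  NormS-repr-<-1 primes 2∉S d x y a b R c free-R (Smooth-∈ p∈S)
    (p∣normNumerator d x y a b R c p∣d p∣c p∣2a+b) N<p/c²
  where instance _ = ℕ.≢-nonZero c≢0

S-norm-Euclidean : ∀ {d S p} → All Prime S → 2 ∉ S → p ∈ S → p ∣ d →
  (∀ ξ → InF ξ → Σ K λ α → InOS S α × Approximation d S p ξ α) → SNormEuclidean d S
S-norm-Euclidean {d} {S} primes 2∉S p∈S p∣d approximate ξ =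
  let open ReductionToF (reduce-to-F primes ξ)
      α , α∈OS , approximation = approximate (repr (+ x) (+ y) R) (InF-repr {{R≢0}} x<R y<R)
  in α +K β , +K-InOS α∈OS β∈OS ,
     subst (λ η → NormS d S η ℚ.< 1ℚ) (sym (trans (-K-+K ξ α β) (cong (_-K α) ξ-β≡)))
       (Approximation⇒NormS-<-1 primes 2∉S p∈S p∣d (+ x) (+ y) R {{R≢0}} R-free approximation)

-- The hypotheses 0 < d, Squarefree d and d % 4 ≡ 3 only make ℤ[w] the ring of integers of K;
-- the argument does not use them.
lemma4 : (d : ℕ) → 0 < d → Squarefree d → d % 4 ≡ 3 →
           (S : List ℕ) → All Prime S → 2 ∉ S →
           (p : ℕ) → p ∈ S → p ∣ d →
           ((x y z : ℤ) → z ≢ + 0 → (∀ q → q ∈ S → ¬ (q ∣ ∣ z ∣)) →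
            (a b : ℤ) (c : ℕ) → InT S c → PCond p a b c →
            NormS d S ((zdiv x z + zdiv y z w) -K repr a b c)
              ℚ.≤ ratio (c ℕ.* c) p ℚ.* Norm d ((zdiv x z + zdiv y z w) -K repr a b c))
           ×
           ((∀ (ξ : K) → InF ξ →
              Σ K λ α → InOS S α ×
                ((Σ ℕ λ c → IsDenomS S α c × (Norm d (ξ -K α) ℚ.< ratio 1 (c ℕ.* c)))
                 ⊎ (Σ ℤ λ a → Σ ℤ λ b → Σ ℕ λ c →
                      RepS S α a b c × PCond p a b c
                      × (Norm d (ξ -K α) ℚ.< ratio p (c ℕ.* c)))))
            → SNormEuclidean d S)
lemma4 d _ _ _ S primes 2∉S p p∈S p∣d =
  PCond⇒NormS-≤ primes 2∉S p∈S p∣d , S-norm-Euclidean primes 2∉S p∈S p∣d
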